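{- Let $\lambda$ be a partition with $n$ parts, all distinct, and let $\kappa,\mu\in S_n(\lambda)$. Then $$c^\kappa_\mu=\sum_{\overline Q\in\overline{\mathcal G}^\kappa_\mu}\mathrm{wt}(\overline Q).$$
   Context: $S_n(\lambda)$ is the set of rearrangements of $\lambda$ in $\mathbb N^n$. Signed two-line queue with top row $\alpha\in\mathbb Z^n$ and bottom row $\mu\in\mathbb N^n$: a $2\times n$ array whose top row has in column $k$ a ball labelled $\alpha_k$ if $\alpha_k\ne0$ (empty otherwise) and whose bottom row has in column $k$ a ball labelled $\mu_k$ if $\mu_k>0$ (empty otherwise), together with a matching of each top ball to a distinct bottom ball such that: (i) a top ball in column $j$ is matched to a bottom ball in a column $k\ge j$; (ii) matched balls have labels of equal absolute value; (iii) a positive top ball labelled $a$ has a ball labelled $a'\ge a$ directly below it, and if $a'=a$ these two are matched; (iv) a negative top ball labelled $-a$ has directly below it either an empty position or a ball labelled $a'\le a$. A pairing is trivial if $j=k$. Process top balls in decreasing order of absolute value, ties right to left, placing pairings in this order; bottom balls not yet matched are free. For nontrivial $p$ from column $j$ to $k>j$, $\mathrm{skipped}(p)$ = number of free bottom balls in columns $j+1,\dots,k-1$, $\mathrm{emp}(p)$ = number of empty bottom positions there; $\mathrm{wt}(p)=\pm(1-t)t^{\mathrm{skipped}(p)+\mathrm{emp}(p)}$ with sign $+$ for a positive top ball and $-$ for a negative one. $\mathrm{wt}_{\mathrm{pair}}(Q)$ is the product over nontrivial pairings; $b^\alpha_\mu=\sum_Q\mathrm{wt}_{\mathrm{pair}}(Q)$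 over signed two-line queues with top row $\alpha$, bottom row $\mu$; $\mathrm{wt}_\alpha=\prod_{k:\alpha_k>0}x_k\prod_{k:\alpha_k<0}(-t^{ -(n-1)})$; and $c^\kappa_\mu=\sum_{\alpha\in\mathbb Z^n:\ (|\alpha_1|,\dots,|\alpha_n|)=\kappa}\mathrm{wt}_\alpha b^\alpha_\mu$. $\overline{\mathcal G}^\kappa_\mu$ is the set of objects $\overline Q$ obtained from signed two-line queues with bottom row $\mu$ and top row $\alpha$ with $(|\alpha_i|)_i=\kappa$ by forgetting signs of top labels (keeping the matching). For $\overline Q$: a nontrivial pairing $p$ has weight $(1-t)t^{\mathrm{skipped}(p)}$; a top ball labelled $a>0$ in column $k$ with label $b$ below it ($b=0$ if empty) has weight $x_k-t^{ -(n-1)}$ if $b=a$, $x_k$ if $b>a$, $t^{ -(n-1)}$ if $b<a$; $\mathrm{wt}(\overline Q)$ is the product of all top-ball and nontrivial pairing weights. -}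

module Defs where

import Data.Nat.Base as ℕ
open import Data.Nat.Base using (ℕ; zero; suc; _∸_; _<_; _≡ᵇ_; _<ᵇ_; _≤ᵇ_)
open import Data.Integer.Base as ℤ using (ℤ; +_; -[1+_]; ∣_∣)
open import Data.Fin.Base using (Fin; toℕ)
open import Data.Fin.Permutation using (Permutation′; _⟨$⟩ʳ_)
open import Data.Bool.Base using (Bool; true; false; _∧_; _∨_; not; if_then_else_)
open import Data.Maybe.Base using (Maybe; just; nothing)
open import Data.List.Base as L using (List; []; _∷_; allFin; filterᵇ; length; map; concatMap; foldr)
open import Data.Bool.ListAction using (any; all)
open import Data.Vec.Functional as V using (Vector)
open import Data.Product using (Σ)
open import Function using (_∘_)
open import Relation.Binary.PropositionalEquality using (_≡_)
open import Algebra.Bundles using (CommutativeRing)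

StrictPartition : ∀ {n} → (Fin n → ℕ) → Set
StrictPartition {n} lam = ∀ (i j : Fin n) → toℕ i < toℕ j → lam j < lam i

_∈S_ : ∀ {n} → (Fin n → ℕ) → (Fin n → ℕ) → Set
_∈S_ {n} κ lam = Σ (Permutation′ n) (λ π → ∀ i → κ i ≡ lam (π ⟨$⟩ʳ i))

allChoices : ∀ {A : Set} (n : ℕ) → (Fin n → List A) → List (Vector A n)
allChoices zero    ch = (λ ()) ∷ []
allChoices (suc n) ch =
  concatMap (λ a → map (a V.∷_) (allChoices n (ch ∘ Fin.suc))) (ch Fin.zero)
  where import Data.Fin.Base as Fin

_==ᶠ_ : ∀ {n} → Fin n → Fin n → Bool
i ==ᶠ j = toℕ i ≡ᵇ toℕ j

-- Matchings: m j = just k means the top ball in column j is matched to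
-- the bottom ball in column k; m j = nothing means column j of the top
-- row holds no ball.

Matching : ℕ → Set
Matching n = Fin n → Maybe (Fin n)

allMatchings : (n : ℕ) → List (Matching n)
allMatchings n = allChoices n (λ _ → nothing ∷ map just (allFin n))

matchedTo : ∀ {n} → Matching n → Fin n → Fin n → Bool
matchedTo m j c with m j
... | nothing = false
... | just k  = k ==ᶠ c

sameTarget : ∀ {n} → Maybe (Fin n) → Maybe (Fin n) → Bool
sameTarget (just a) (just b) = a ==ᶠ b
sameTarget _        _        = false

injectiveᵇ : ∀ {n} → Matching n → Bool
injectiveᵇ {n} m =
  all (λ i → all (λ j → (i ==ᶠ j) ∨ not (sameTarget (m i) (m j))) (allFin n)) (allFin n)

isPos : ℤ → Bool
isPos (+ zero)  = false
isPos (+ suc _) = true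
isPos -[1+ _ ]  = false

isNeg : ℤ → Bool
isNeg -[1+ _ ] = true
isNeg (+ _)    = false

absRow : ∀ {n} → (Fin n → ℤ) → Fin n → ℕ
absRow α i = ∣ α i ∣

signedRows : ∀ {n} → (Fin n → ℕ) → List (Fin n → ℤ)
signedRows {n} κ =
  allChoices n (λ i → if κ i ≡ᵇ 0 then (+ 0 ∷ []) else (+ κ i ∷ ℤ.- (+ κ i) ∷ []))

-- Signed two-line queues (top row α, bottom row μ, matching m)

columnOK : ∀ {n} → (Fin n → ℤ) → (Fin n → ℕ) → Matching n → Fin n → Bool
columnOK α μ m j = ballOK (m j) ∧ posOK ∧ negOK
  where
  a = ∣ α j ∣
  -- top ball present iff α j ≠ 0; (i) k ≥ j; bottom ball present; (ii) equal |labels|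
  ballOK : Maybe _ → Bool
  ballOK nothing  = a ≡ᵇ 0
  ballOK (just k) = not (a ≡ᵇ 0) ∧ (toℕ j ≤ᵇ toℕ k) ∧ not (μ k ≡ᵇ 0) ∧ (a ≡ᵇ μ k)
  posOK = if isPos (α j)
          then (a ≤ᵇ μ j) ∧ (if μ j ≡ᵇ a then matchedTo m j j else true)
          else true
  -- (iv)  (an empty position below is μ j = 0 ≤ a)
  negOK = if isNeg (α j) then μ j ≤ᵇ a else true

isSignedQueue : ∀ {n} → (Fin n → ℤ) → (Fin n → ℕ) → Matching n → Bool
isSignedQueue {n} α μ m = all (columnOK α μ m) (allFin n) ∧ injectiveᵇ m

-- objects of \overline{G}^κ_μ: matchings m (with unsigned top row κ) that
-- arise from some signed two-line queue with top row α, |α| = κ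
isUnsignedQueue : ∀ {n} → (Fin n → ℕ) → (Fin n → ℕ) → Matching n → Bool
isUnsignedQueue κ μ m = any (λ α → isSignedQueue α μ m) (signedRows κ)

-- top ball q is processed (strictly) before top ball j:
-- decreasing absolute value, ties right to left
earlier : ∀ {n} → (Fin n → ℕ) → Fin n → Fin n → Bool
earlier κ q j = (κ j <ᵇ κ q) ∨ ((κ q ≡ᵇ κ j) ∧ (toℕ j <ᵇ toℕ q))

strictlyBetween : ∀ {n} → Fin n → Fin n → Fin n → Bool
strictlyBetween j k c = (toℕ j <ᵇ toℕ c) ∧ (toℕ c <ᵇ toℕ k)

freeAt : ∀ {n} → (Fin n → ℕ) → (Fin n → ℕ) → Matching n → Fin n → Fin n → Bool
freeAt {n} κ μ m j c =
  not (μ c ≡ᵇ 0) ∧ not (any (λ q → earlier κ q j ∧ matchedTo m q c) (allFin n))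

skipped : ∀ {n} → (Fin n → ℕ) → (Fin n → ℕ) → Matching n → Fin n → Fin n → ℕ
skipped {n} κ μ m j k =
  length (filterᵇ (λ c → strictlyBetween j k c ∧ freeAt κ μ m j c) (allFin n))

emp : ∀ {n} → (Fin n → ℕ) → Fin n → Fin n → ℕ
emp {n} μ j k = length (filterᵇ (λ c → strictlyBetween j k c ∧ (μ c ≡ᵇ 0)) (allFin n))

-- Weights, valued in a commutative ring R containing x₁,…,xₙ, t and an
-- inverse t⁻¹ of t (the statement assumes t * t⁻¹ ≈ 1).

module Weights {c ℓ} (R : CommutativeRing c ℓ) {n : ℕ}
               (x : Fin n → CommutativeRing.Carrier R)
               (t t⁻¹ : CommutativeRing.Carrier R) where
  open CommutativeRing R

  pow : Carrier → ℕ → Carrier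
  pow a zero    = 1#
  pow a (suc k) = a * pow a k

  sumL : List Carrier → Carrier
  sumL = foldr _+_ 0#

  prodFin : (Fin n → Carrier) → Carrier
  prodFin f = foldr (λ i r → f i * r) 1# (allFin n)

  tneg : Carrier
  tneg = pow t⁻¹ (n ∸ 1)

  signedPairWt : (Fin n → ℤ) → (Fin n → ℕ) → Matching n → Fin n → Carrier
  signedPairWt α μ m j with m j
  ... | nothing = 1#
  ... | just k  =
    if j ==ᶠ k then 1#
    else ((if isPos (α j) then 1# else - 1#) * ((1# - t) *
           pow t (skipped (absRow α) μ m j k ℕ.+ emp μ j k)))

  wtPair : (Fin n → ℤ) → (Fin n → ℕ) → Matching n → Carrier
  wtPair α μ m = prodFin (signedPairWt α μ m)

  b : (Fin n → ℤ) → (Fin n → ℕ) → Carrier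
  b α μ = sumL (map (wtPair α μ) (filterᵇ (isSignedQueue α μ) (allMatchings n)))

  wtα : (Fin n → ℤ) → Carrier
  wtα α = prodFin (λ k → if isPos (α k) then x k
                         else if isNeg (α k) then - tneg else 1#)

  coeff : (Fin n → ℕ) → (Fin n → ℕ) → Carrier
  coeff κ μ = sumL (map (λ α → wtα α * b α μ) (signedRows κ))

  topWt : (Fin n → ℕ) → (Fin n → ℕ) → Fin n → Carrier
  topWt κ μ k =
    if κ k ≡ᵇ 0 then 1#
    else if μ k ≡ᵇ κ k then x k - tneg
    else if κ k <ᵇ μ k then x k
    else tneg

  unsignedPairWt : (Fin n → ℕ) → (Fin n → ℕ) → Matching n → Fin n → Carrier
  unsignedPairWt κ μ m j with m j
  ... | nothing = 1#
  ... | just k  = if j ==ᶠ k then 1# else (1# - t) * pow t (skipped κ μ m j k)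

  wtBar : (Fin n → ℕ) → (Fin n → ℕ) → Matching n → Carrier
  wtBar κ μ m = prodFin (topWt κ μ) * prodFin (unsignedPairWt κ μ m)

  sumGbar : (Fin n → ℕ) → (Fin n → ℕ) → Carrier
  sumGbar κ μ = sumL (map (wtBar κ μ) (filterᵇ (isUnsignedQueue κ μ) (allMatchings n)))

{-# OPTIONS --safe #-}
module Submission where

-- Fix the matching. Once |α| = κ is fixed, conditions (i)-(iv) and the weight
-- wt_α · wt_pair(Q) of a signed queue split into factors, one per column, each
-- depending only on the sign of that column's top ball; so the sum over the sign
-- vectors α factorises into a product over the columns of a sum over at most two
-- signs. A column whose top ball a is matched rightwards to an equal label
-- contributes x_k if the label b below it exceeds a (only the positive sign is
-- allowed), t^-(n-1) if b < a (only the negative sign, whose two minus signs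
-- cancel), and x_k - t^-(n-1) if b = a (both signs; the parts being distinct, the
-- pairing is then trivial). The signed pairing weight also carries t^emp, which is 1:
-- there is at most one empty bottom position c, every bottom label left of c comes
-- from a top ball weakly to its left, so all pairings left of c are trivial and no
-- pairing passes over c.

open import Defs
open import Algebra.Bundles using (CommutativeRing)
open import Data.Bool.Base using (Bool; true; false; T; _∧_; _∨_; not; if_then_else_)
open import Data.Bool.Properties using (∧-zeroʳ; ∨-assoc; ∧-distribˡ-∨; ∧-distribʳ-∨; T-∧)
open import Data.Bool.ListAction using (any; all; and; or)
open import Data.Fin.Base using (Fin; zero; suc; toℕ)
open import Data.Fin.Permutation using (Permutation′; _⟨$⟩ʳ_; _∘ₚ_; flip; inverseʳ)
open import Data.Fin.Properties using (toℕ-injective; injective⇒existsPivot)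
open import Data.Integer.Base as ℤ using (ℤ; +_; ∣_∣)
open import Data.List.Base
  using (List; []; _∷_; _++_; map; concatMap; foldr; filterᵇ; allFin; tabulate; length)
open import Data.List.Properties using (map-cong; map-∘; map-tabulate; filter-none; filter-≐)
open import Data.List.Membership.Propositional.Properties using (∈-allFin)
open import Data.List.Relation.Unary.All as All using (All; []; _∷_)
open import Data.List.Relation.Unary.All.Properties using (concat⁺; map⁺; all⁺)
open import Data.List.Relation.Unary.Any.Properties using (any⁻)
open import Data.Maybe.Base using (just; nothing)
open import Data.Maybe.Properties using (just-injective)
import Data.Nat.Base as ℕ
open import Data.Nat.Base using (ℕ; zero; suc; _≤_; _<_; _≡ᵇ_; _<ᵇ_; _≤ᵇ_)
import Data.Nat.Properties as ℕₚ
open import Data.Nat.Properties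
  using (_≟_; _<?_; _≤?_; ≡ᵇ⇒≡; <ᵇ⇒<; ≤ᵇ⇒≤; ≤-antisym; ≤-trans; <-trans; ≤-<-trans; <⇒≢; <-cmp;
         <-asym; n<1+n; <⇒≤; <⇒≱; >⇒≢)
open import Data.Product using (∃-syntax; _×_; _,_; proj₁)
import Data.Vec.Functional as V
open import Function using (_∘_; id; Injective)
open import Function.Bundles using (Equivalence; Injection)
open import Function.Properties.Inverse using (↔⇒↣)
open import Relation.Binary.Definitions using (tri<; tri≈; tri>)
open import Relation.Binary.PropositionalEquality as ≡
  using (_≡_; _≢_; _≗_; refl; cong; cong₂; subst; module ≡-Reasoning)
open import Relation.Nullary using (¬_; yes; no; contradiction)
open import Relation.Nullary.Decidable using (T?; dec-true; dec-false)

private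
  variable
    A B : Set

≡ᵇ-true : ∀ {a b} → a ≡ b → (a ≡ᵇ b) ≡ true
≡ᵇ-true {a} {b} = dec-true (a ≟ b)

≡ᵇ-false : ∀ {a b} → a ≢ b → (a ≡ᵇ b) ≡ false
≡ᵇ-false {a} {b} = dec-false (a ≟ b)

<ᵇ-true : ∀ {a b} → a < b → (a <ᵇ b) ≡ true
<ᵇ-true {a} {b} = dec-true (a <? b)

<ᵇ-false : ∀ {a b} → ¬ a < b → (a <ᵇ b) ≡ false
<ᵇ-false {a} {b} = dec-false (a <? b)

≤ᵇ-true : ∀ {a b} → a ≤ b → (a ≤ᵇ b) ≡ true
≤ᵇ-true {a} {b} = dec-true (a ≤? b)

≤ᵇ-false : ∀ {a b} → ¬ a ≤ b → (a ≤ᵇ b) ≡ false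
≤ᵇ-false {a} {b} = dec-false (a ≤? b)

T-∧⁴ : ∀ a b c d {r} → T ((a ∧ b ∧ c ∧ d) ∧ r) → T a × T b × T c × T d
T-∧⁴ true  true  true  true  _  = _ , _ , _ , _
T-∧⁴ false _     _     _     ()
T-∧⁴ true  false _     _     ()
T-∧⁴ true  true  false _     ()
T-∧⁴ true  true  true  false ()

filterᵇ-cong : ∀ {p q : A → Bool} → p ≗ q → ∀ xs → filterᵇ p xs ≡ filterᵇ q xs
filterᵇ-cong p≗q =
  filter-≐ (T? ∘ _) (T? ∘ _) ((λ {a} → subst T (p≗q a)) , (λ {a} → subst T (≡.sym (p≗q a))))

any-cong : ∀ {p q : A → Bool} → p ≗ q → ∀ xs → any p xs ≡ any q xs
any-cong p≗q xs = cong or (map-cong p≗q xs)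

all-cong : ∀ {p q : A → Bool} → p ≗ q → ∀ xs → all p xs ≡ all q xs
all-cong p≗q xs = cong and (map-cong p≗q xs)

any-map : ∀ (p : B → Bool) (f : A → B) xs → any p (map f xs) ≡ any (p ∘ f) xs
any-map p f xs = cong or (≡.sym (map-∘ xs))

any-++ : ∀ (p : A → Bool) xs ys → any p (xs ++ ys) ≡ any p xs ∨ any p ys
any-++ p []       ys = refl
any-++ p (x ∷ xs) ys = ≡.trans (cong (p x ∨_) (any-++ p xs ys)) (≡.sym (∨-assoc (p x) _ _))

any-concatMap : ∀ (p : B → Bool) (f : A → List B) xs →
                any p (concatMap f xs) ≡ any (any p ∘ f) xs
any-concatMap p f []       = refl
any-concatMap p f (x ∷ xs) =
  ≡.trans (any-++ p (f x) (concatMap f xs)) (cong (any p (f x) ∨_) (any-concatMap p f xs))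

any-∧ˡ : ∀ b (p : A → Bool) xs → any (λ a → b ∧ p a) xs ≡ b ∧ any p xs
any-∧ˡ b p []       = ≡.sym (∧-zeroʳ b)
any-∧ˡ b p (x ∷ xs) =
  ≡.trans (cong (b ∧ p x ∨_) (any-∧ˡ b p xs)) (≡.sym (∧-distribˡ-∨ b (p x) (any p xs)))

any-∧ʳ : ∀ b (p : A → Bool) xs → any (λ a → p a ∧ b) xs ≡ any p xs ∧ b
any-∧ʳ b p []       = refl
any-∧ʳ b p (x ∷ xs) =
  ≡.trans (cong (p x ∧ b ∨_) (any-∧ʳ b p xs)) (≡.sym (∧-distribʳ-∨ b (p x) (any p xs)))

all-allFin-suc : ∀ {m} (p : Fin (suc m) → Bool) →
                 all p (allFin (suc m)) ≡ p zero ∧ all (p ∘ suc) (allFin m)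
all-allFin-suc {m} p =
  cong (λ bs → p zero ∧ and bs) (≡.trans (map-tabulate suc p) (≡.sym (map-tabulate id (p ∘ suc))))


any-allChoices-all : ∀ {A : Set} m (ch : Fin m → List A) (p : Fin m → A → Bool) →
  any (λ α → all (λ j → p j (α j)) (allFin m)) (allChoices m ch) ≡
  all (λ j → any (p j) (ch j)) (allFin m)
any-allChoices-all zero    ch p = refl
any-allChoices-all {A} (suc m) ch p = begin
  any Pᵐ⁺¹ (concatMap (λ a → map (a V.∷_) rest) (ch zero))
    ≡⟨ any-concatMap Pᵐ⁺¹ _ (ch zero) ⟩
  any (λ a → any Pᵐ⁺¹ (map (a V.∷_) rest)) (ch zero)
    ≡⟨ any-cong any-cons (ch zero) ⟩
  any (λ a → p zero a ∧ any Pᵐ rest) (ch zero)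
    ≡⟨ any-∧ʳ (any Pᵐ rest) (p zero) (ch zero) ⟩
  any (p zero) (ch zero) ∧ any Pᵐ rest
    ≡⟨ cong (any (p zero) (ch zero) ∧_) (any-allChoices-all m (ch ∘ suc) (p ∘ suc)) ⟩
  any (p zero) (ch zero) ∧ all (λ j → any (p (suc j)) (ch (suc j))) (allFin m)
    ≡⟨ ≡.sym (all-allFin-suc (λ j → any (p j) (ch j))) ⟩
  all (λ j → any (p j) (ch j)) (allFin (suc m)) ∎
  where
  open ≡-Reasoning
  rest : List (V.Vector A m)
  rest = allChoices m (ch ∘ suc)
  Pᵐ⁺¹ : V.Vector A (suc m) → Bool
  Pᵐ⁺¹ α = all (λ j → p j (α j)) (allFin (suc m))
  Pᵐ : V.Vector A m → Bool
  Pᵐ β = all (λ j → p (suc j) (β j)) (allFin m)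
  any-cons : ∀ a → any Pᵐ⁺¹ (map (a V.∷_) rest) ≡ p zero a ∧ any Pᵐ rest
  any-cons a = ≡.trans (any-map Pᵐ⁺¹ (a V.∷_) rest)
                 (≡.trans (any-cong (λ β → all-allFin-suc (λ j → p j ((a V.∷ β) j))) rest)
                          (any-∧ˡ (p zero a) Pᵐ rest))

allChoices-All : ∀ m {ch : Fin m → List A} {P : Fin m → A → Set} →
  (∀ i → All (P i) (ch i)) → All (λ α → ∀ i → P i (α i)) (allChoices m ch)
allChoices-All zero    _   = (λ ()) ∷ []
allChoices-All (suc m) {ch} {P} all-ch = concat⁺ (map⁺ (All.map extend (all-ch zero)))
  where
  extend : ∀ {a} → P zero a → All (λ α → ∀ i → P i (α i)) (map (a V.∷_) (allChoices m (ch ∘ suc)))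
  extend pa = map⁺ (All.map (λ pβ → λ { zero → pa ; (suc i) → pβ i })
                            (allChoices-All m (all-ch ∘ suc)))

module RingSums {c ℓ} (R : CommutativeRing c ℓ) where

  open CommutativeRing R hiding (zero) renaming (refl to ≈-refl)
  open import Algebra.Properties.CommutativeSemigroup +-commutativeSemigroup using (interchange)
  open import Algebra.Properties.CommutativeMonoid.Sum *-commutativeMonoid
    public using ()
    renaming (sum to ∏; sum-cong-≋ to ∏-cong; sum-cong-≗ to ∏-cong-≗; ∑-distrib-+ to ∏-distrib-*)
  open import Relation.Binary.Reasoning.Setoid setoid

  ∑ : List A → (A → Carrier) → Carrier
  ∑ xs f = foldr _+_ 0# (map f xs)

  [_]·_ : Bool → Carrier → Carrier
  [ b ]· x = if b then x else 0#

  []·-cong : ∀ b {x y} → x ≈ y → [ b ]· x ≈ [ b ]· y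
  []·-cong true  x≈y = x≈y
  []·-cong false _   = ≈-refl

  []·-∧ : ∀ a b x → [ a ∧ b ]· x ≡ [ b ]· ([ a ]· x)
  []·-∧ true  b     x = refl
  []·-∧ false true  x = refl
  []·-∧ false false x = refl

  ∑-cong : ∀ {f g : A → Carrier} → (∀ a → f a ≈ g a) → ∀ xs → ∑ xs f ≈ ∑ xs g
  ∑-cong f≈g []       = ≈-refl
  ∑-cong f≈g (x ∷ xs) = +-cong (f≈g x) (∑-cong f≈g xs)

  ∑-congᴬ : ∀ {P : A → Set} {f g : A → Carrier} → (∀ {a} → P a → f a ≈ g a) →
            ∀ {xs} → All P xs → ∑ xs f ≈ ∑ xs g
  ∑-congᴬ f≈g []         = ≈-refl
  ∑-congᴬ f≈g (px ∷ pxs) = +-cong (f≈g px) (∑-congᴬ f≈g pxs)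

  ∑-zero : ∀ {f : A → Carrier} → (∀ a → f a ≈ 0#) → ∀ xs → ∑ xs f ≈ 0#
  ∑-zero f≈0 []       = ≈-refl
  ∑-zero f≈0 (x ∷ xs) = trans (+-cong (f≈0 x) (∑-zero f≈0 xs)) (+-identityʳ 0#)

  ∑-[]· : ∀ b (f : A → Carrier) xs → ∑ xs (λ a → [ b ]· f a) ≈ [ b ]· ∑ xs f
  ∑-[]· true  f xs = ≈-refl
  ∑-[]· false f xs = ∑-zero (λ _ → ≈-refl) xs

  ∑-++ : ∀ (f : A → Carrier) xs ys → ∑ (xs ++ ys) f ≈ ∑ xs f + ∑ ys f
  ∑-++ f []       ys = sym (+-identityˡ _)
  ∑-++ f (x ∷ xs) ys = trans (+-congˡ (∑-++ f xs ys)) (sym (+-assoc (f x) _ _))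

  ∑-concatMap : ∀ (f : B → Carrier) (g : A → List B) xs →
                ∑ (concatMap g xs) f ≈ ∑ xs (λ a → ∑ (g a) f)
  ∑-concatMap f g []       = ≈-refl
  ∑-concatMap f g (x ∷ xs) =
    trans (∑-++ f (g x) (concatMap g xs)) (+-congˡ (∑-concatMap f g xs))

  ∑-map : ∀ (f : B → Carrier) (g : A → B) xs → ∑ (map g xs) f ≡ ∑ xs (f ∘ g)
  ∑-map f g xs = cong (foldr _+_ 0#) (≡.sym (map-∘ xs))

  ∑-+ : ∀ (f g : A → Carrier) xs → ∑ xs (λ a → f a + g a) ≈ ∑ xs f + ∑ xs g
  ∑-+ f g []       = sym (+-identityˡ 0#)
  ∑-+ f g (x ∷ xs) = trans (+-congˡ (∑-+ f g xs)) (interchange (f x) (g x) _ _)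

  *-∑ : ∀ k (f : A → Carrier) xs → k * ∑ xs f ≈ ∑ xs (λ a → k * f a)
  *-∑ k f []       = zeroʳ k
  *-∑ k f (x ∷ xs) = trans (distribˡ k _ _) (+-congˡ (*-∑ k f xs))

  ∑-* : ∀ k (f : A → Carrier) xs → ∑ xs f * k ≈ ∑ xs (λ a → f a * k)
  ∑-* k f []       = zeroˡ k
  ∑-* k f (x ∷ xs) = trans (distribʳ k _ _) (+-congˡ (∑-* k f xs))

  ∑-comm : ∀ (f : A → B → Carrier) xs ys →
           ∑ xs (λ a → ∑ ys (f a)) ≈ ∑ ys (λ b → ∑ xs (λ a → f a b))
  ∑-comm f []       ys = sym (∑-zero (λ _ → ≈-refl) ys)
  ∑-comm f (x ∷ xs) ys =
    trans (+-congˡ (∑-comm f xs ys)) (sym (∑-+ (f x) (λ b → ∑ xs (λ a → f a b)) ys))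

  ∑-filterᵇ : ∀ (p : A → Bool) (f : A → Carrier) xs →
              ∑ (filterᵇ p xs) f ≈ ∑ xs (λ a → [ p a ]· f a)
  ∑-filterᵇ p f []       = ≈-refl
  ∑-filterᵇ p f (x ∷ xs) with p x
  ... | true  = +-congˡ (∑-filterᵇ p f xs)
  ... | false = trans (∑-filterᵇ p f xs) (sym (+-identityˡ _))

  *-[]· : ∀ k b x → k * [ b ]· x ≈ [ b ]· (k * x)
  *-[]· k true  x = ≈-refl
  *-[]· k false x = zeroʳ k

  foldr-tabulate≡∏ : ∀ {m} (f : A → Carrier) (h : Fin m → A) →
                     foldr (λ i r → f i * r) 1# (tabulate h) ≡ ∏ (f ∘ h)
  foldr-tabulate≡∏ {m = zero}  f h = refl
  foldr-tabulate≡∏ {m = suc m} f h = cong (f (h zero) *_) (foldr-tabulate≡∏ f (h ∘ suc))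

  foldr-allFin≡∏ : ∀ {m} (f : Fin m → Carrier) → foldr (λ i r → f i * r) 1# (allFin m) ≡ ∏ f
  foldr-allFin≡∏ f = foldr-tabulate≡∏ f id

  []·-∏ : ∀ {m} (p : Fin m → Bool) (f : Fin m → Carrier) →
          [ all p (allFin m) ]· ∏ f ≈ ∏ (λ j → [ p j ]· f j)
  []·-∏ {zero}  p f = ≈-refl
  []·-∏ {suc m} p f rewrite all-allFin-suc p with p zero
  ... | true  = trans (sym (*-[]· (f zero) _ _)) (*-congˡ ([]·-∏ (p ∘ suc) (f ∘ suc)))
  ... | false = sym (zeroˡ _)

  ∑-allChoices-∏ : ∀ m (ch : Fin m → List A) (g : Fin m → A → Carrier) →
    ∑ (allChoices m ch) (λ α → ∏ (λ j → g j (α j))) ≈ ∏ (λ j → ∑ (ch j) (g j))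
  ∑-allChoices-∏ zero    ch g = +-identityʳ 1#
  ∑-allChoices-∏ {A} (suc m) ch g = begin
    ∑ (concatMap (λ a → map (a V.∷_) rest) (ch zero)) Gᵐ⁺¹
      ≈⟨ ∑-concatMap Gᵐ⁺¹ _ (ch zero) ⟩
    ∑ (ch zero) (λ a → ∑ (map (a V.∷_) rest) Gᵐ⁺¹)
      ≈⟨ ∑-cong (λ a → reflexive (∑-map Gᵐ⁺¹ (a V.∷_) rest)) (ch zero) ⟩
    ∑ (ch zero) (λ a → ∑ rest (λ β → g zero a * Gᵐ β))
      ≈⟨ ∑-cong (λ a → sym (*-∑ (g zero a) Gᵐ rest)) (ch zero) ⟩
    ∑ (ch zero) (λ a → g zero a * ∑ rest Gᵐ)
      ≈⟨ sym (∑-* (∑ rest Gᵐ) (g zero) (ch zero)) ⟩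
    ∑ (ch zero) (g zero) * ∑ rest Gᵐ
      ≈⟨ *-congˡ (∑-allChoices-∏ m (ch ∘ suc) (g ∘ suc)) ⟩
    ∑ (ch zero) (g zero) * ∏ (λ j → ∑ (ch (suc j)) (g (suc j))) ∎
    where
    rest : List (V.Vector A m)
    rest = allChoices m (ch ∘ suc)
    Gᵐ⁺¹ : V.Vector A (suc m) → Carrier
    Gᵐ⁺¹ α = ∏ (λ j → g j (α j))
    Gᵐ : V.Vector A m → Carrier
    Gᵐ β = ∏ (λ j → g (suc j) (β j))

RightwardMatching : ∀ {n} → (Fin n → ℕ) → (Fin n → ℕ) → Matching n → Set
RightwardMatching κ μ m = ∀ j → κ j ≢ 0 → ∃[ k ] m j ≡ just k × toℕ j ≤ toℕ k × μ k ≡ κ j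

module _ {n} {κ μ : Fin n → ℕ} {m : Matching n}
         (μ-injective : Injective _≡_ _≡_ μ)
         (ρ : Permutation′ n) (μ≗κ∘ρ : ∀ d → μ d ≡ κ (ρ ⟨$⟩ʳ d))
         (rightward : RightwardMatching κ μ m) where

  matched-from-ρ : ∀ d → μ d ≢ 0 → m (ρ ⟨$⟩ʳ d) ≡ just d × toℕ (ρ ⟨$⟩ʳ d) ≤ toℕ d
  matched-from-ρ d μd≢0 with rightward (ρ ⟨$⟩ʳ d) (μd≢0 ∘ ≡.trans (μ≗κ∘ρ d))
  ... | k , mρd≡k , ρd≤k , μk≡κρd with μ-injective (≡.trans μk≡κρd (≡.sym (μ≗κ∘ρ d)))
  ... | refl = mρd≡k , ρd≤k

  nonzero-left-of-empty : ∀ {c d} → μ c ≡ 0 → toℕ d < toℕ c → μ d ≢ 0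
  nonzero-left-of-empty μc≡0 d<c μd≡0 =
    <⇒≢ d<c (cong toℕ (μ-injective (≡.trans μd≡0 (≡.sym μc≡0))))

  trivial-left-of-empty : ∀ {c j} → μ c ≡ 0 → toℕ j < toℕ c → m j ≡ just j
  -- The pivot d ≤ j ≤ ρ d, together with ρ d ≤ d, forces d = ρ d = j.
  trivial-left-of-empty {c} {j} μc≡0 j<c
    with d , d≤j , j≤ρd ← injective⇒existsPivot (Injection.injective (↔⇒↣ ρ)) j
    with mρd≡d , ρd≤d ← matched-from-ρ d (nonzero-left-of-empty μc≡0 (≤-<-trans d≤j j<c)) =
    let d≡j  = toℕ-injective (≤-antisym d≤j (≤-trans j≤ρd ρd≤d))
        ρd≡j = toℕ-injective (≤-antisym (≤-trans ρd≤d d≤j) j≤ρd)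
    in ≡.trans (cong m (≡.sym ρd≡j)) (≡.trans mρd≡d (cong just d≡j))

  emp≡0 : ∀ {j k} → m j ≡ just k → emp μ j k ≡ 0
  emp≡0 {j} {k} mj≡k =
    cong length (filter-none (T? ∘ emptyBetween) (All.universal ¬emptyBetween (allFin n)))
    where
    emptyBetween : Fin n → Bool
    emptyBetween c = strictlyBetween j k c ∧ (μ c ≡ᵇ 0)
    ¬emptyBetween : ∀ c → ¬ T (emptyBetween c)
    ¬emptyBetween c hole with between , μc≡0 ← Equivalence.to T-∧ hole
                         with j<c , c<k ← Equivalence.to T-∧ between =
      let mj≡j = trivial-left-of-empty (≡ᵇ⇒≡ _ _ μc≡0) (<ᵇ⇒< _ _ j<c)
      in <⇒≢ (<-trans (<ᵇ⇒< _ _ j<c) (<ᵇ⇒< _ _ c<k)) (cong toℕ (just-injective (≡.trans (≡.sym mj≡j) mj≡k)))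

strictPartition-injective : ∀ {n} {lam : Fin n → ℕ} → StrictPartition lam → Injective _≡_ _≡_ lam
strictPartition-injective {lam = lam} decreasing {i} {j} lamᵢ≡lamⱼ with <-cmp (toℕ i) (toℕ j)
... | tri< i<j _ _ = contradiction (≡.sym lamᵢ≡lamⱼ) (<⇒≢ (decreasing i j i<j))
... | tri≈ _ i≡j _ = toℕ-injective i≡j
... | tri> _ _ j<i = contradiction lamᵢ≡lamⱼ (<⇒≢ (decreasing j i j<i))

∈S-injective : ∀ {n} {μ lam : Fin n → ℕ} → StrictPartition lam → μ ∈S lam → Injective _≡_ _≡_ μ
∈S-injective decreasing (σ , μ≗lam∘σ) μᵢ≡μⱼ =
  Injection.injective (↔⇒↣ σ) (strictPartition-injective decreasing
    (≡.trans (≡.sym (μ≗lam∘σ _)) (≡.trans μᵢ≡μⱼ (μ≗lam∘σ _))))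

∈S-rearrangement : ∀ {n} {κ μ lam : Fin n → ℕ} → κ ∈S lam → μ ∈S lam → μ ∈S κ
∈S-rearrangement {lam = lam} (π , κ≗lam∘π) (σ , μ≗lam∘σ) = σ ∘ₚ flip π , λ d →
  ≡.trans (μ≗lam∘σ d) (≡.trans (cong lam (≡.sym (inverseʳ π))) (≡.sym (κ≗lam∘π _)))

signs : ℕ → List ℤ
signs a = if a ≡ᵇ 0 then (+ 0 ∷ []) else (+ a ∷ ℤ.- (+ a) ∷ [])

∣signs∣ : ∀ a → All (λ s → ∣ s ∣ ≡ a) (signs a)
∣signs∣ zero    = refl ∷ []
∣signs∣ (suc a) = refl ∷ refl ∷ []

module _ {n} {κ κ′ : Fin n → ℕ} (κ≗κ′ : κ ≗ κ′) (μ : Fin n → ℕ) (m : Matching n) where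

  earlier-cong : ∀ q j → earlier κ q j ≡ earlier κ′ q j
  earlier-cong q j rewrite κ≗κ′ q | κ≗κ′ j = refl

  skipped-cong : ∀ j k → skipped κ μ m j k ≡ skipped κ′ μ m j k
  skipped-cong j k = cong length (filterᵇ-cong free-cong (allFin n))
    where
    free-cong : ∀ c → (strictlyBetween j k c ∧ freeAt κ μ m j c) ≡
                      (strictlyBetween j k c ∧ freeAt κ′ μ m j c)
    free-cong c = cong (λ b → strictlyBetween j k c ∧ (not (μ c ≡ᵇ 0) ∧ not b))
                       (any-cong (λ q → cong (_∧ matchedTo m q c) (earlier-cong q j)) (allFin n))

module Columns {c ℓ} (R : CommutativeRing c ℓ) {n : ℕ}
               (x : Fin n → CommutativeRing.Carrier R) (t t⁻¹ : CommutativeRing.Carrier R)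
               {κ μ : Fin n → ℕ} (μ-injective : Injective _≡_ _≡_ μ) (m : Matching n) where

  open CommutativeRing R hiding (zero) renaming (refl to ≈-refl)
  open Weights R x t t⁻¹
  open RingSums R
  open import Algebra.Properties.Ring ring using (-1*x≈-x; -‿distribˡ-*; -‿distribʳ-*; -‿involutive)
  open import Relation.Binary.Reasoning.Setoid setoid

  columnOKAt : Fin n → ℤ → Bool
  columnOKAt j s = columnOK (λ _ → s) μ m j

  columnOK-local : ∀ α j → columnOK α μ m j ≡ columnOKAt j (α j)
  columnOK-local α j with m j
  ... | nothing = refl
  ... | just k  = refl

  wtαAt : Fin n → ℤ → Carrier
  wtαAt k s = if isPos s then x k else if isNeg s then - tneg else 1#

  signedPairWtAt : Fin n → ℤ → Carrier
  signedPairWtAt j s with m j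
  ... | nothing = 1#
  ... | just k  = if j ==ᶠ k then 1#
                  else ((if isPos s then 1# else - 1#) *
                        ((1# - t) * pow t (skipped κ μ m j k ℕ.+ emp μ j k)))

  signedPairWt-local : ∀ α → (∀ i → ∣ α i ∣ ≡ κ i) →
                       ∀ j → signedPairWt α μ m j ≡ signedPairWtAt j (α j)
  signedPairWt-local α ∣α∣≗κ j with m j
  ... | nothing = refl
  ... | just k rewrite skipped-cong ∣α∣≗κ μ m j k = refl

  pairMagnitude : Fin n → Carrier
  pairMagnitude j with m j
  ... | nothing = 1#
  ... | just k  = if j ==ᶠ k then 1# else (1# - t) * pow t (skipped κ μ m j k ℕ.+ emp μ j k)

  columnTerm : Fin n → ℤ → Carrier
  columnTerm j s = [ columnOKAt j s ]· (wtαAt j s * signedPairWtAt j s)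

  realizable : Fin n → Bool
  realizable j = any (columnOKAt j) (signs (κ j))

  allRealizable : Bool
  allRealizable = all realizable (allFin n)

  columnsOK : (Fin n → ℤ) → Bool
  columnsOK α = all (columnOK α μ m) (allFin n)

  signedWt : (Fin n → ℤ) → Carrier
  signedWt α = wtα α * wtPair α μ m

  ==ᶠ-false : ∀ {j k b} → μ k ≡ b → μ j ≢ b → (toℕ j ≡ᵇ toℕ k) ≡ false
  ==ᶠ-false μk≡b μj≢b = ≡ᵇ-false (λ e → μj≢b (≡.trans (cong μ (toℕ-injective e)) μk≡b))

  -x*-y≈x*y : ∀ u v → - u * - v ≈ u * v
  -x*-y≈x*y u v = begin
    - u * - v     ≈⟨ sym (-‿distribˡ-* u (- v)) ⟩
    - (u * - v)   ≈⟨ -‿cong (sym (-‿distribʳ-* u v)) ⟩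
    - - (u * v)   ≈⟨ -‿involutive (u * v) ⟩
    u * v         ∎

  0+[0+0]≈0 : 0# + (0# + 0#) ≈ 0#
  0+[0+0]≈0 = trans (+-identityˡ _) (+-identityʳ 0#)

  negative-only : ∀ u v → 0# + (- u * (- 1# * v) + 0#) ≈ u * v
  negative-only u v = begin
    0# + (- u * (- 1# * v) + 0#)  ≈⟨ trans (+-identityˡ _) (+-identityʳ _) ⟩
    - u * (- 1# * v)              ≈⟨ *-congˡ (-1*x≈-x v) ⟩
    - u * - v                     ≈⟨ -x*-y≈x*y u v ⟩
    u * v                         ∎

  positive-only : ∀ u v → u * (1# * v) + (0# + 0#) ≈ u * v
  positive-only u v = trans (+-cong (*-congˡ (*-identityˡ v)) (+-identityʳ 0#)) (+-identityʳ _)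

  both-signs : ∀ u v → u * 1# + (- v * 1# + 0#) ≈ (u - v) * 1#
  both-signs u v = begin
    u * 1# + (- v * 1# + 0#)  ≈⟨ +-congˡ (+-identityʳ _) ⟩
    u * 1# + - v * 1#         ≈⟨ sym (distribʳ 1# u (- v)) ⟩
    (u - v) * 1#              ∎

  column-sum : ∀ j →
               ∑ (signs (κ j)) (columnTerm j) ≈ [ realizable j ]· (topWt κ μ j * pairMagnitude j)
  column-sum j with κ j
  ... | zero with m j
  ...   | nothing = +-identityʳ _
  ...   | just k  = +-identityʳ _
  column-sum j | suc a with m j
  ... | nothing = 0+[0+0]≈0
  ... | just k with μ k ≟ suc a
  ...   | no μk≢
    rewrite ≡ᵇ-false (μk≢ ∘ ≡.sym) | ∧-zeroʳ (not (μ k ≡ᵇ 0)) | ∧-zeroʳ (toℕ j ≤ᵇ toℕ k) = 0+[0+0]≈0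
  ...   | yes μk≡ rewrite μk≡ | ≡ᵇ-true {a} refl with toℕ j ≤ᵇ toℕ k
  ...     | false = 0+[0+0]≈0
  ...     | true with <-cmp (μ j) (suc a)
  ...       | tri< μj< _ _
    rewrite ≤ᵇ-false (<⇒≱ μj<) | ≡ᵇ-false (<⇒≢ μj<) | ≤ᵇ-true (<⇒≤ μj<) | <ᵇ-false (<-asym μj<)
          | ==ᶠ-false μk≡ (<⇒≢ μj<) = negative-only _ _
  ...       | tri> _ _ μj>
    rewrite ≤ᵇ-true (<⇒≤ μj>) | ≡ᵇ-false (>⇒≢ μj>) | ≤ᵇ-false (<⇒≱ μj>) | <ᵇ-true μj>
          | ==ᶠ-false μk≡ (>⇒≢ μj>) = positive-only _ _
  ...       | tri≈ _ μj≡ _ with μ-injective (≡.trans μj≡ (≡.sym μk≡))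
  ...         | refl
    rewrite μj≡ | ≡ᵇ-true {a} refl | ≡ᵇ-true {toℕ j} refl | <ᵇ-true (n<1+n a) = both-signs _ _

  columnOKAt-matched : ∀ j s → T (columnOKAt j s) → ∣ s ∣ ≢ 0 →
                       ∃[ k ] m j ≡ just k × toℕ j ≤ toℕ k × μ k ≡ ∣ s ∣
  columnOKAt-matched j s ok ∣s∣≢0 with m j | ok
  ... | nothing | nothing-ok =
    contradiction (≡ᵇ⇒≡ ∣ s ∣ 0 (proj₁ (Equivalence.to T-∧ nothing-ok))) ∣s∣≢0
  ... | just k  | ball-ok
    with _ , j≤k , _ , ∣s∣≡μk ←
           T-∧⁴ (not (∣ s ∣ ≡ᵇ 0)) (toℕ j ≤ᵇ toℕ k) (not (μ k ≡ᵇ 0)) (∣ s ∣ ≡ᵇ μ k) ball-ok =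
    k , refl , ≤ᵇ⇒≤ _ _ j≤k , ≡.sym (≡ᵇ⇒≡ _ _ ∣s∣≡μk)

  realizable⇒rightward : T allRealizable → RightwardMatching κ μ m
  realizable⇒rightward all-realizable j κj≢0 =
    let realizable-j  = All.lookup (all⁺ realizable (allFin n) all-realizable) (∈-allFin j)
        ∣s∣≡κj , ok   = All.lookupAny (∣signs∣ (κ j)) (any⁻ (columnOKAt j) (signs (κ j)) realizable-j)
        k , mj≡k , j≤k , μk≡∣s∣ = columnOKAt-matched j _ ok (κj≢0 ∘ ≡.trans (≡.sym ∣s∣≡κj))
    in k , mj≡k , j≤k , ≡.trans μk≡∣s∣ ∣s∣≡κj

  module _ (ρ : Permutation′ n) (μ≗κ∘ρ : ∀ d → μ d ≡ κ (ρ ⟨$⟩ʳ d)) where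

    pairMagnitude≡unsignedPairWt : RightwardMatching κ μ m →
                                   ∀ j → pairMagnitude j ≡ unsignedPairWt κ μ m j
    pairMagnitude≡unsignedPairWt rightward j with m j in mj≡
    ... | nothing = refl
    ... | just k
      rewrite emp≡0 μ-injective ρ μ≗κ∘ρ rightward mj≡ | ℕₚ.+-identityʳ (skipped κ μ m j k) = refl

    magnitudes-unsigned :
      [ allRealizable ]· ∏ (λ j → topWt κ μ j * pairMagnitude j) ≈
      [ allRealizable ]· ∏ (λ j → topWt κ μ j * unsignedPairWt κ μ m j)
    magnitudes-unsigned with allRealizable in all-realizable
    ... | false = ≈-refl
    ... | true  = ∏-cong (λ j → *-congˡ (reflexive (pairMagnitude≡unsignedPairWt rightward j)))
      where rightward = realizable⇒rightward (subst T (≡.sym all-realizable) _)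

    signedQueueWt-∏ : ∀ α → (∀ i → ∣ α i ∣ ≡ κ i) →
      [ columnsOK α ]· signedWt α ≈ ∏ (λ j → columnTerm j (α j))
    signedQueueWt-∏ α ∣α∣≗κ = begin
      [ columnsOK α ]· signedWt α
        ≡⟨ cong₂ [_]·_ (all-cong (columnOK-local α) (allFin n))
                       (cong₂ _*_ (foldr-allFin≡∏ w)
                                  (≡.trans (foldr-allFin≡∏ (signedPairWt α μ m))
                                           (∏-cong-≗ (signedPairWt-local α ∣α∣≗κ)))) ⟩
      [ all ok (allFin n) ]· (∏ w * ∏ p)
        ≈⟨ []·-cong _ (sym (∏-distrib-* w p)) ⟩
      [ all ok (allFin n) ]· ∏ (λ j → w j * p j)
        ≈⟨ []·-∏ ok (λ j → w j * p j) ⟩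
      ∏ (λ j → columnTerm j (α j)) ∎
      where
      ok : Fin n → Bool
      ok j = columnOKAt j (α j)
      w p : Fin n → Carrier
      w j = wtαAt j (α j)
      p j = signedPairWtAt j (α j)

    sum-over-signs :
      ∑ (signedRows κ) (λ α → [ columnsOK α ]· signedWt α) ≈
      [ allRealizable ]· wtBar κ μ m
    sum-over-signs = begin
      ∑ (signedRows κ) (λ α → [ columnsOK α ]· signedWt α)
        ≈⟨ ∑-congᴬ (λ {α} → signedQueueWt-∏ α) (allChoices-All n (∣signs∣ ∘ κ)) ⟩
      ∑ (signedRows κ) (λ α → ∏ (λ j → columnTerm j (α j)))
        ≈⟨ ∑-allChoices-∏ n (signs ∘ κ) columnTerm ⟩
      ∏ (λ j → ∑ (signs (κ j)) (columnTerm j))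
        ≈⟨ ∏-cong column-sum ⟩
      ∏ (λ j → [ realizable j ]· (topWt κ μ j * pairMagnitude j))
        ≈⟨ sym ([]·-∏ realizable (λ j → topWt κ μ j * pairMagnitude j)) ⟩
      [ allRealizable ]· ∏ (λ j → topWt κ μ j * pairMagnitude j)
        ≈⟨ magnitudes-unsigned ⟩
      [ allRealizable ]· ∏ (λ j → topWt κ μ j * unsignedPairWt κ μ m j)
        ≈⟨ []·-cong _ (∏-distrib-* (topWt κ μ) (unsignedPairWt κ μ m)) ⟩
      [ allRealizable ]· (∏ (topWt κ μ) * ∏ (unsignedPairWt κ μ m))
        ≡⟨ cong [ allRealizable ]·_
                (≡.sym (cong₂ _*_ (foldr-allFin≡∏ (topWt κ μ)) (foldr-allFin≡∏ (unsignedPairWt κ μ m)))) ⟩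
      [ allRealizable ]· wtBar κ μ m ∎

    isUnsignedQueue≡realizable∧injective : isUnsignedQueue κ μ m ≡ allRealizable ∧ injectiveᵇ m
    isUnsignedQueue≡realizable∧injective = ≡.trans (any-∧ʳ (injectiveᵇ m) _ (signedRows κ))
      (cong (_∧ injectiveᵇ m)
        (≡.trans (any-cong (λ α → all-cong (columnOK-local α) (allFin n)) (signedRows κ))
                 (any-allChoices-all n (signs ∘ κ) columnOKAt)))

    matching-contribution :
      ∑ (signedRows κ) (λ α → [ isSignedQueue α μ m ]· signedWt α) ≈
      [ isUnsignedQueue κ μ m ]· wtBar κ μ m
    matching-contribution = begin
      ∑ (signedRows κ) (λ α → [ isSignedQueue α μ m ]· signedWt α)
        ≈⟨ ∑-cong (λ α → reflexive ([]·-∧ (columnsOK α) (injectiveᵇ m) (signedWt α))) (signedRows κ) ⟩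
      ∑ (signedRows κ) (λ α → [ injectiveᵇ m ]· ([ columnsOK α ]· signedWt α))
        ≈⟨ ∑-[]· (injectiveᵇ m) _ (signedRows κ) ⟩
      [ injectiveᵇ m ]· ∑ (signedRows κ) (λ α → [ columnsOK α ]· signedWt α)
        ≈⟨ []·-cong (injectiveᵇ m) sum-over-signs ⟩
      [ injectiveᵇ m ]· ([ allRealizable ]· wtBar κ μ m)
        ≡⟨ ≡.sym ([]·-∧ allRealizable (injectiveᵇ m) (wtBar κ μ m)) ⟩
      [ allRealizable ∧ injectiveᵇ m ]· wtBar κ μ m
        ≡⟨ cong (λ b → [ b ]· wtBar κ μ m) (≡.sym isUnsignedQueue≡realizable∧injective) ⟩
      [ isUnsignedQueue κ μ m ]· wtBar κ μ m ∎

module _ {c ℓ} (R : CommutativeRing c ℓ) {n : ℕ}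
         (x : Fin n → CommutativeRing.Carrier R) (t t⁻¹ : CommutativeRing.Carrier R) where

  open CommutativeRing R
  open Weights R x t t⁻¹
  open RingSums R
  open import Relation.Binary.Reasoning.Setoid setoid

  coeff≈sumGbar : ∀ {κ μ} → Injective _≡_ _≡_ μ → μ ∈S κ → coeff κ μ ≈ sumGbar κ μ
  coeff≈sumGbar {κ} {μ} μ-injective (ρ , μ≗κ∘ρ) = begin
    coeff κ μ
      ≈⟨ ∑-cong expand (signedRows κ) ⟩
    ∑ (signedRows κ) (λ α → ∑ (allMatchings n) (term α))
      ≈⟨ ∑-comm term (signedRows κ) (allMatchings n) ⟩
    ∑ (allMatchings n) (λ m → ∑ (signedRows κ) (λ α → term α m))
      ≈⟨ ∑-cong (λ m → Columns.matching-contribution R x t t⁻¹ μ-injective m ρ μ≗κ∘ρ) (allMatchings n) ⟩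
    ∑ (allMatchings n) (λ m → [ isUnsignedQueue κ μ m ]· wtBar κ μ m)
      ≈⟨ sym (∑-filterᵇ (isUnsignedQueue κ μ) (wtBar κ μ) (allMatchings n)) ⟩
    sumGbar κ μ ∎
    where
    term : (Fin n → ℤ) → Matching n → Carrier
    term α m = [ isSignedQueue α μ m ]· (wtα α * wtPair α μ m)
    expand : ∀ α → wtα α * b α μ ≈ ∑ (allMatchings n) (term α)
    expand α = begin
      wtα α * b α μ
        ≈⟨ *-congˡ (∑-filterᵇ (isSignedQueue α μ) (wtPair α μ) (allMatchings n)) ⟩
      wtα α * ∑ (allMatchings n) (λ m → [ isSignedQueue α μ m ]· wtPair α μ m)
        ≈⟨ *-∑ (wtα α) _ (allMatchings n) ⟩
      ∑ (allMatchings n) (λ m → wtα α * [ isSignedQueue α μ m ]· wtPair α μ m)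
        ≈⟨ ∑-cong (λ m → *-[]· (wtα α) (isSignedQueue α μ m) (wtPair α μ m)) (allMatchings n) ⟩
      ∑ (allMatchings n) (term α) ∎

lemma2p9 : ∀ {c ℓ} (R : CommutativeRing c ℓ) (n : ℕ)
           (lam : Fin n → ℕ) → StrictPartition lam →
           (κ μ : Fin n → ℕ) → κ ∈S lam → μ ∈S lam →
           (x : Fin n → CommutativeRing.Carrier R)
           (t t⁻¹ : CommutativeRing.Carrier R) →
           CommutativeRing._≈_ R (CommutativeRing._*_ R t t⁻¹) (CommutativeRing.1# R) →
           CommutativeRing._≈_ R (Weights.coeff R x t t⁻¹ κ μ) (Weights.sumGbar R x t t⁻¹ κ μ)
lemma2p9 R n lam decreasing κ μ κ∈S μ∈S x t t⁻¹ _ =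
  coeff≈sumGbar R x t t⁻¹ (∈S-injective decreasing μ∈S) (∈S-rearrangement {lam = lam} κ∈S μ∈S)
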